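{- Let $\mathcal{O}$ be a cube orientation with outmap $\phi_{\mathcal{O}}$ and carrier $C$, let $R\subseteq C$, and let $\mathcal{O}'=\mathcal{O}\oplus R$ be the cube orientation on the same vertex set with outmap $\phi_{\mathcal{O}'}(V)=\phi_{\mathcal{O}}(V)\oplus R$ for all vertices $V$. Then $\mathcal{O}$ has property L if and only if $\mathcal{O}'$ has property L.
   Context: Notation: $\oplus$ is symmetric difference; $[U,W]=\{X:U\subseteq X\subseteq W\}$. A cube orientation is a directed graph with vertex set $[U,W]$ containing exactly one of the edges $(V,V\oplus\{i\})$, $(V\oplus\{i\},V)$ for every $V\in[U,W]$ and $i\in C:=W\setminus U$ (the carrier). Its outmap is $\phi(V)=\{i\in C: (V,V\oplus\{i\})\text{ is an edge}\}$; a cube orientation is determined by its outmap. The L-graph of $V$ has vertex set $W\setminus V$ and an arc $(i,j)$ for distinct $i,j\in W\setminus V$ whenever $j\in\phi(V)\oplus\phi(V\cup\{i\})$; property L means all L-graphs are acyclic. -}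

module Defs where

open import Data.Nat using (ℕ)
open import Data.Fin using (Fin)
open import Data.Bool using (_xor_)
open import Data.Vec using (zipWith)
open import Data.Fin.Subset using (Subset; _∈_; _∉_; _⊆_; _∪_; _─_; ⁅_⁆)
open import Data.Product using (_×_)
open import Relation.Binary.PropositionalEquality using (_≢_)
open import Relation.Binary.Construct.Closure.Transitive using (TransClosure)
open import Relation.Nullary using (¬_)
open import Function.Bundles using (_⇔_)

infixl 6 _⊕_
_⊕_ : ∀ {n} → Subset n → Subset n → Subset n
_⊕_ = zipWith _xor_

InInterval : ∀ {n} → Subset n → Subset n → Subset n → Set
InInterval U W X = (U ⊆ X) × (X ⊆ W)

Carrier : ∀ {n} → Subset n → Subset n → Subset n
Carrier U W = W ─ U

-- An outmap φ (only its values on [U,W] are relevant) is the outmap of a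
-- cube orientation on [U,W]: outmap values lie in the carrier, and each
-- edge {V, V ⊕ {i}} (i ∈ C) is oriented in exactly one direction, i.e.
-- (V, V⊕{i}) is an edge iff (V⊕{i}, V) is not.
record IsCubeOrientation {n} (U W : Subset n) (φ : Subset n → Subset n) : Set where
  field
    U⊆W      : U ⊆ W
    φ⊆C      : ∀ V → InInterval U W V → φ V ⊆ Carrier U W
    oneWay   : ∀ V → InInterval U W V → ∀ i → i ∈ Carrier U W →
               (i ∈ φ V) ⇔ (i ∉ φ (V ⊕ ⁅ i ⁆))

LArc : ∀ {n} (W : Subset n) (φ : Subset n → Subset n) (V : Subset n) →
       Fin n → Fin n → Set
LArc W φ V i j =
  (i ∈ W ─ V) × (j ∈ W ─ V) × (i ≢ j) × (j ∈ φ V ⊕ φ (V ∪ ⁅ i ⁆))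

Acyclic : ∀ {n} → (Fin n → Fin n → Set) → Set
Acyclic {n} A = ∀ (i : Fin n) → ¬ TransClosure A i i

PropertyL : ∀ {n} (U W : Subset n) (φ : Subset n → Subset n) → Set
PropertyL U W φ = ∀ V → InInterval U W V → Acyclic (LArc W φ V)

-- The L-graph of V only sees the differences φ V ⊕ φ (V ∪ {i}), and translating
-- every outmap value by the same R leaves these differences unchanged: the L-graphs
-- of φ and of φ ⊕ R coincide.
module Submission where

open import Defs
open import Data.Nat using (ℕ)
open import Data.Bool using (true; false; not; _xor_)
open import Data.Bool.Properties using (xor-same; xor-inverseˡ; xor-inverseʳ)
open import Data.Fin using (Fin)
open import Data.Fin.Subset using (Subset; _⊆_; _∪_; ⁅_⁆)
open import Data.Vec using ([]; _∷_)
open import Data.Product using (_,_)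
open import Function.Base using (id)
open import Function.Bundles using (_⇔_; mk⇔)
open import Relation.Binary.Core using (Rel; _⇒_)
open import Relation.Binary.PropositionalEquality using (_≡_; refl; sym; cong₂; subst)
open import Relation.Binary.Construct.Closure.Transitive using (TransClosure; [_]; _∷_)

xor-translation-invariant : ∀ a b r → (a xor r) xor (b xor r) ≡ a xor b
xor-translation-invariant false false r = xor-same r
xor-translation-invariant false true  r = xor-inverseʳ r
xor-translation-invariant true  false r = xor-inverseˡ r
xor-translation-invariant true  true  r = xor-same (not r)

⊕-translation-invariant : ∀ {n} (a b r : Subset n) → (a ⊕ r) ⊕ (b ⊕ r) ≡ a ⊕ b
⊕-translation-invariant []       []       []       = refl
⊕-translation-invariant (x ∷ a) (y ∷ b) (z ∷ r) =
  cong₂ _∷_ (xor-translation-invariant x y z) (⊕-translation-invariant a b r)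

TransClosure-map : ∀ {a ℓ₁ ℓ₂} {A : Set a} {P : Rel A ℓ₁} {Q : Rel A ℓ₂} →
                   P ⇒ Q → TransClosure P ⇒ TransClosure Q
TransClosure-map P⇒Q [ x∼y ]      = [ P⇒Q x∼y ]
TransClosure-map P⇒Q (x∼y ∷ y∼⁺z) = P⇒Q x∼y ∷ TransClosure-map P⇒Q y∼⁺z

Acyclic-⊆ : ∀ {n} {P Q : Fin n → Fin n → Set} → P ⇒ Q → Acyclic Q → Acyclic P
Acyclic-⊆ P⇒Q acyclic i cycle = acyclic i (TransClosure-map P⇒Q cycle)

LArc-⊕-invariant : ∀ {n} W (φ : Subset n → Subset n) R V i j →
                   LArc W (λ X → φ X ⊕ R) V i j ≡ LArc W φ V i j
LArc-⊕-invariant W φ R V i j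
  rewrite ⊕-translation-invariant (φ V) (φ (V ∪ ⁅ i ⁆)) R = refl

PropertyL-⊕-invariant : ∀ {n} (U W : Subset n) φ R →
                        PropertyL U W φ ⇔ PropertyL U W (λ V → φ V ⊕ R)
PropertyL-⊕-invariant U W φ R = mk⇔
  (λ L V V∈[U,W] → Acyclic-⊆ (subst id (LArc-⊕-invariant W φ R V _ _)) (L V V∈[U,W]))
  (λ L V V∈[U,W] → Acyclic-⊆ (subst id (sym (LArc-⊕-invariant W φ R V _ _))) (L V V∈[U,W]))

mainTheorem6 : (n : ℕ) (U W : Subset n) (φ : Subset n → Subset n) →
    IsCubeOrientation U W φ → (R : Subset n) → R ⊆ Carrier U W →
    PropertyL U W φ ⇔ PropertyL U W (λ V → φ V ⊕ R)
mainTheorem6 n U W φ _ R _ = PropertyL-⊕-invariant U W φ R
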